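{- Let $a=a_1\cdots a_n$ be a nonempty word of distinct positive integers, $i=a_1$, and let $a^{<i}$, $a^{>i}$ be the subwords of $a$ (in the original order) consisting of the entries less than $i$ and greater than $i$, respectively. Then: if $a^{<i},a^{>i}\ne\emptyset$, $h(a)=_{\mathcal I}(\mathbf 2^i\circ_2h(a^{>i}))\circ_1h(a^{<i})$; if $a^{<i}=\emptyset\ne a^{>i}$, $h(a)=_{\mathcal I}\mathbf 2^i\circ_2h(a^{>i})$; if $a^{>i}=\emptyset\ne a^{<i}$, $h(a)=_{\mathcal I}\mathbf 2^i\circ_1h(a^{<i})$; and if $a=i$, $h(a)=\mathbf 2^i$.
   Context: Indexed terms: $\mathcal L^I$ is generated by symbols $\mathbf 2^k$ ($k$ a positive integer) of arity $2$, and for terms $\mathbf A,\mathbf B$ and $1\le m\le|\mathbf A|$ the term $\mathbf A\circ_m\mathbf B$ of arity $|\mathbf A|+|\mathbf B|-1$; no index occurs more than once. $=_{\mathcal I}$ is the smallest congruence on $\mathcal L^I$ containing all instances of (assoc1) $(\mathbf A\circ_n\mathbf B)\circ_m\mathbf C=\mathbf A\circ_n(\mathbf B\circ_{m-n+1}\mathbf C)$ if $n\le m<n+|\mathbf B|$, and (assoc2) $(\mathbf A\circ_n\mathbf B)\circ_m\mathbf C=(\mathbf A\circ_{m-|\mathbf B|+1}\mathbf C)\circ_n\mathbf B$ if $n+|\mathbf B|\le m$. Head-insertion encoding: $h(a_1)=\mathbf 2^{a_1}$, and for $n>1$, $h(a)=h(a_1\cdots a_{n-1})\circ_r\mathbf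 2^{a_n}$ with $r=1+|\{j<n:a_j<a_n\}|$. -}

module Defs where

open import Data.Nat using (ℕ; zero; suc; _+_; _∸_; _≤_; _<_; _<?_)
open import Data.List using (List; []; _∷_; _++_; [_]; filter; length)
open import Data.List.Relation.Unary.All using (All)
open import Data.List.Relation.Unary.Unique.Propositional using (Unique)
open import Data.Product using (_×_)
open import Data.Unit using (⊤)

-- Raw indexed terms:  two k  is the symbol 2^k,  comp A m B  is  A ∘_m B.
data Term : Set where
  two  : ℕ → Term
  comp : Term → ℕ → Term → Term

ar : Term → ℕ
ar (two k)      = 2
ar (comp A m B) = ar A + ar B ∸ 1

idx : Term → List ℕ
idx (two k)      = k ∷ []
idx (comp A m B) = idx A ++ idx B

ValidPos : Term → Set
ValidPos (two k)      = ⊤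
ValidPos (comp A m B) = ValidPos A × ValidPos B × (1 ≤ m) × (m ≤ ar A)

-- membership in L^I: valid positions, positive indices, no index occurs twice
WF : Term → Set
WF t = ValidPos t × All (1 ≤_) (idx t) × Unique (idx t)

-- =_I : smallest congruence on L^I containing (assoc1), (assoc2).
-- Every generator only relates members of L^I.
infix 4 _=I_
data _=I_ : Term → Term → Set where
  ≈refl  : ∀ {A} → WF A → A =I A
  ≈sym   : ∀ {A B} → A =I B → B =I A
  ≈trans : ∀ {A B C} → A =I B → B =I C → A =I C
  ≈cong  : ∀ {A A′ B B′} m → WF (comp A m B) → WF (comp A′ m B′) →
           A =I A′ → B =I B′ → comp A m B =I comp A′ m B′
  assoc1 : ∀ A B C n m → WF (comp (comp A n B) m C) →
           n ≤ m → m < n + ar B →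
           comp (comp A n B) m C =I comp A n (comp B (m ∸ n + 1) C)
  assoc2 : ∀ A B C n m → WF (comp (comp A n B) m C) →
           n + ar B ≤ m →
           comp (comp A n B) m C =I comp (comp A (m ∸ ar B + 1) C) n B

countLess : ℕ → List ℕ → ℕ
countLess y xs = length (filter (_<? y) xs)

hGo : Term → List ℕ → List ℕ → Term
hGo t prev []       = t
hGo t prev (y ∷ ys) = hGo (comp t (1 + countLess y prev) (two y)) (prev ++ [ y ]) ys

-- h (a₁ a₂ ⋯ aₙ) written  h a₁ (a₂ ⋯ aₙ)  (h is only defined on nonempty words)
h : ℕ → List ℕ → Term
h a₁ as = hGo (two a₁) [ a₁ ] as

below : ℕ → List ℕ → List ℕ
below i a = filter (_<? i) a

above : ℕ → List ℕ → List ℕ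
above i a = filter (i <?_) a

{-# OPTIONS --safe #-}

-- h is a left fold, so we insert the letters of a one at a time and keep the invariant
-- h(i a₂⋯aₖ) =_I (2^i ∘₂ h(a^{>i})) ∘₁ h(a^{<i}) for every prefix.  A new letter y sits at
-- position 1 + #{x < y} of h.  If y < i this position lies inside the h(a^{<i}) grafted at
-- position 1, and (assoc1) pushes 2^y into it, where it lands exactly where h puts it.  If
-- y > i the position lies beyond h(a^{<i}); (assoc2) moves 2^y past h(a^{<i}) and (assoc1)
-- then pushes it into h(a^{>i}).  Since ≈cong only relates members of L^I, rewriting under
-- a composition needs that =_I preserves membership in L^I, arity and the indices.
module Submission where

open import Defs
open import Level using (Level)
open import Algebra.Properties.CommutativeSemigroup using (xy∙z≈xz∙y; x∙yz≈y∙xz)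
open import Data.Nat using (ℕ; suc; _+_; _∸_; _≤_; _<_; _<?_; z≤n; s≤s)
open import Data.Nat.Properties
open import Data.List using (List; []; _∷_; _++_; _∷ʳ_; [_]; filter; length)
open import Data.List.Properties using (++-assoc; ++-identityʳ; length-++; length-filter; filter-++; filter-accept; filter-reject; filter-all; filter-none)
open import Data.List.Reverse using (Reverse; reverseView; []; _∶_∶ʳ_)
open import Data.List.Relation.Unary.All as All using (All; []; _∷_)
import Data.List.Relation.Unary.All.Properties as All
open import Data.List.Relation.Unary.AllPairs as AllPairs using ([]; _∷_)
open import Data.List.Relation.Unary.Unique.Propositional using (Unique)
open import Data.List.Relation.Binary.Permutation.Propositional using (_↭_; ↭-refl; ↭-reflexive; ↭-sym; ↭-trans; ↭⇒↭ₛ)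
import Data.List.Relation.Binary.Permutation.Propositional.Properties as ↭
open import Data.Product using (_×_; _,_; proj₁; proj₂)
open import Data.Unit using (tt)
open import Function using (_∘_)
open import Relation.Binary using (Tri; tri<; tri≈; tri>)
open import Relation.Binary.PropositionalEquality hiding ([_])
open import Data.List.Relation.Binary.Permutation.Setoid.Properties (setoid ℕ) using (Unique-resp-↭)
open import Relation.Nullary using (¬_; contradiction)
open import Relation.Unary using (Pred; Decidable)

private variable
  a ℓ : Level
  A : Set a

Unique-++⁻ˡ : ∀ (xs : List A) {ys} → Unique (xs ++ ys) → Unique xs
Unique-++⁻ˡ []       _           = []
Unique-++⁻ˡ (x ∷ xs) (x∉ ∷ uniq) = All.++⁻ˡ xs x∉ ∷ Unique-++⁻ˡ xs uniq

Unique-++⁻ʳ : ∀ (xs : List A) {ys} → Unique (xs ++ ys) → Unique ys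
Unique-++⁻ʳ []       uniq       = uniq
Unique-++⁻ʳ (x ∷ xs) (_ ∷ uniq) = Unique-++⁻ʳ xs uniq

++-swapʳ : ∀ (xs ys zs : List A) → (xs ++ ys) ++ zs ↭ (xs ++ zs) ++ ys
++-swapʳ xs ys zs = ↭-trans (↭-reflexive (++-assoc xs ys zs))
  (↭-trans (↭.++⁺ˡ xs (↭.++-comm ys zs)) (↭-reflexive (sym (++-assoc xs zs ys))))

module _ {P : Pred A ℓ} (P? : Decidable P) where

  filter-∷ʳ-accept : ∀ {x} xs → P x → filter P? (xs ∷ʳ x) ≡ filter P? xs ∷ʳ x
  filter-∷ʳ-accept xs px = trans (filter-++ P? xs _) (cong (filter P? xs ++_) (filter-accept P? px))

  filter-∷ʳ-reject : ∀ {x} xs → ¬ P x → filter P? (xs ∷ʳ x) ≡ filter P? xs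
  filter-∷ʳ-reject xs ¬px = trans (filter-++ P? xs _)
    (trans (cong (filter P? xs ++_) (filter-reject P? ¬px)) (++-identityʳ _))

-- Arity is handled through size, which avoids the truncated subtraction in ar.
size : Term → ℕ
size (two _)      = 0
size (comp A _ B) = suc (size A + size B)

ar≡2+size : ∀ t → ar t ≡ 2 + size t
ar≡2+size (two _)      = refl
ar≡2+size (comp A _ B) rewrite ar≡2+size A | ar≡2+size B =
  cong suc (trans (+-suc (size A) _) (cong suc (+-suc (size A) (size B))))

1≤ar : ∀ t → 1 ≤ ar t
1≤ar t rewrite ar≡2+size t = s≤s z≤n

ar≤ar-compˡ : ∀ A m C → ar A ≤ ar (comp A m C)
ar≤ar-compˡ A m C = subst (ar A ≤_) (sym (+-∸-assoc (ar A) (1≤ar C))) (m≤m+n (ar A) (ar C ∸ 1))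

assoc1-pos≤ : ∀ {n m b} → n ≤ m → m < n + b → m ∸ n + 1 ≤ b
assoc1-pos≤ {n} {m} {b} n≤m m<n+b = begin
  m ∸ n + 1 ≡⟨ +-∸-comm 1 n≤m ⟨
  m + 1 ∸ n ≤⟨ m≤n+o⇒m∸n≤o (m + 1) n (subst (_≤ n + b) (+-comm 1 m) m<n+b) ⟩
  b         ∎
  where open ≤-Reasoning

assoc2-pos≤ : ∀ {m} A B → m ≤ ar A + ar B ∸ 1 → m ∸ ar B + 1 ≤ ar A
assoc2-pos≤ {m} A B rewrite ar≡2+size A | ar≡2+size B = λ m≤ →
  subst (_≤ 2 + size A) (+-comm 1 _)
    (s≤s (m≤n+o⇒m∸n≤o m (2 + size B) (subst (m ≤_) (+-comm (suc (size A)) _) m≤)))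

WF-compˡ : ∀ {A m B} → WF (comp A m B) → WF A
WF-compˡ {A} ((vA , _) , pos , uniq) = vA , All.++⁻ˡ (idx A) pos , Unique-++⁻ˡ (idx A) uniq

WF-compʳ : ∀ {A m B} → WF (comp A m B) → WF B
WF-compʳ {A} ((_ , vB , _) , pos , uniq) = vB , All.++⁻ʳ (idx A) pos , Unique-++⁻ʳ (idx A) uniq

WF-resp-↭ : ∀ {s t} → ValidPos t → idx s ↭ idx t → WF s → WF t
WF-resp-↭ vt s↭t (_ , pos , uniq) = vt , ↭.All-resp-↭ s↭t pos , Unique-resp-↭ (↭⇒↭ₛ s↭t) uniq

assoc1-WF : ∀ A B C n m → WF (comp (comp A n B) m C) → n ≤ m → m < n + ar B →
            WF (comp A n (comp B (m ∸ n + 1) C))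
assoc1-WF A B C n m w@(((vA , vB , 1≤n , n≤A) , vC , _) , _) n≤m m<n+B =
  WF-resp-↭ (vA , (vB , vC , m≤n+m 1 _ , assoc1-pos≤ n≤m m<n+B) , 1≤n , n≤A)
            (↭-reflexive (++-assoc (idx A) (idx B) (idx C))) w

assoc2-WF : ∀ A B C n m → WF (comp (comp A n B) m C) →
            WF (comp (comp A (m ∸ ar B + 1) C) n B)
assoc2-WF A B C n m w@(((vA , vB , 1≤n , n≤A) , vC , _ , m≤AB) , _) =
  WF-resp-↭ ((vA , vC , m≤n+m 1 _ , assoc2-pos≤ A B m≤AB) , vB , 1≤n ,
             ≤-trans n≤A (ar≤ar-compˡ A (m ∸ ar B + 1) C))
            (++-swapʳ (idx A) (idx B) (idx C)) w

=I⇒WF : ∀ {A B} → A =I B → WF A × WF B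
=I⇒WF (≈refl w)                  = w , w
=I⇒WF (≈sym A≈B)                 = proj₂ (=I⇒WF A≈B) , proj₁ (=I⇒WF A≈B)
=I⇒WF (≈trans A≈B B≈C)           = proj₁ (=I⇒WF A≈B) , proj₂ (=I⇒WF B≈C)
=I⇒WF (≈cong _ w w′ _ _)         = w , w′
=I⇒WF (assoc1 A B C n m w n≤m m<n+B) = w , assoc1-WF A B C n m w n≤m m<n+B
=I⇒WF (assoc2 A B C n m w _)     = w , assoc2-WF A B C n m w

=I⇒size≡ : ∀ {A B} → A =I B → size A ≡ size B
=I⇒size≡ (≈refl _)                = refl
=I⇒size≡ (≈sym A≈B)               = sym (=I⇒size≡ A≈B)
=I⇒size≡ (≈trans A≈B B≈C)         = trans (=I⇒size≡ A≈B) (=I⇒size≡ B≈C)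
=I⇒size≡ (≈cong _ _ _ A≈A′ B≈B′)  = cong suc (cong₂ _+_ (=I⇒size≡ A≈A′) (=I⇒size≡ B≈B′))
=I⇒size≡ (assoc1 A B C _ _ _ _ _) =
  cong suc (trans (cong suc (+-assoc (size A) (size B) (size C))) (sym (+-suc (size A) _)))
=I⇒size≡ (assoc2 A B C _ _ _ _)   =
  cong (suc ∘ suc) (xy∙z≈xz∙y +-commutativeSemigroup (size A) (size B) (size C))

=I⇒ar≡ : ∀ {A B} → A =I B → ar A ≡ ar B
=I⇒ar≡ {A} {B} A≈B rewrite ar≡2+size A | ar≡2+size B = cong (2 +_) (=I⇒size≡ A≈B)

=I⇒idx↭ : ∀ {A B} → A =I B → idx A ↭ idx B
=I⇒idx↭ (≈refl _)                = ↭-refl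
=I⇒idx↭ (≈sym A≈B)               = ↭-sym (=I⇒idx↭ A≈B)
=I⇒idx↭ (≈trans A≈B B≈C)         = ↭-trans (=I⇒idx↭ A≈B) (=I⇒idx↭ B≈C)
=I⇒idx↭ (≈cong _ _ _ A≈A′ B≈B′)  = ↭.++⁺ (=I⇒idx↭ A≈A′) (=I⇒idx↭ B≈B′)
=I⇒idx↭ (assoc1 A B C _ _ _ _ _) = ↭-reflexive (++-assoc (idx A) (idx B) (idx C))
=I⇒idx↭ (assoc2 A B C _ _ _ _)   = ++-swapʳ (idx A) (idx B) (idx C)

comp-congˡ : ∀ {A A′ m B} → A =I A′ → WF (comp A m B) → comp A m B =I comp A′ m B
comp-congˡ {m = m} {B} A≈A′ w@((_ , vB , 1≤m , m≤A) , _) =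
  ≈cong m w w′ A≈A′ (≈refl (WF-compʳ w))
  where
  w′ = WF-resp-↭ (proj₁ (proj₂ (=I⇒WF A≈A′)) , vB , 1≤m , subst (m ≤_) (=I⇒ar≡ A≈A′) m≤A)
                 (↭.++⁺ʳ (idx B) (=I⇒idx↭ A≈A′)) w

hGo-∷ʳ : ∀ t q p y → hGo t q (p ∷ʳ y) ≡ comp (hGo t q p) (1 + countLess y (q ++ p)) (two y)
hGo-∷ʳ t q []      y rewrite ++-identityʳ q = refl
hGo-∷ʳ t q (x ∷ p) y rewrite hGo-∷ʳ (comp t (1 + countLess x q) (two x)) (q ∷ʳ x) p y
                           | ++-assoc q [ x ] p = refl

idx-hGo : ∀ t q p → idx (hGo t q p) ≡ idx t ++ p
idx-hGo t q []      = sym (++-identityʳ (idx t))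
idx-hGo t q (x ∷ p) rewrite idx-hGo (comp t (1 + countLess x q) (two x)) (q ∷ʳ x) p =
  ++-assoc (idx t) [ x ] p

size-hGo : ∀ t q p → size (hGo t q p) ≡ size t + length p
size-hGo t q []      = sym (+-identityʳ (size t))
size-hGo t q (x ∷ p) rewrite size-hGo (comp t (1 + countLess x q) (two x)) (q ∷ʳ x) p
                           | +-identityʳ (size t) = sym (+-suc (size t) (length p))

ValidPos-hGo : ∀ t q p → ValidPos t → ar t ≡ suc (length q) → ValidPos (hGo t q p)
ValidPos-hGo t q []      vt _      = vt
ValidPos-hGo t q (x ∷ p) vt ar≡1+q = ValidPos-hGo _ (q ∷ʳ x) p
  (vt , tt , s≤s z≤n , subst (1 + countLess x q ≤_) (sym ar≡1+q) (s≤s (length-filter (_<? x) q)))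
  (begin
    ar t + 2 ∸ 1           ≡⟨ cong (λ k → k + 2 ∸ 1) ar≡1+q ⟩
    length q + 2           ≡⟨ +-suc (length q) 1 ⟩
    suc (length q + 1)     ≡⟨ cong suc (length-++ q) ⟨
    suc (length (q ∷ʳ x))  ∎)
  where open ≡-Reasoning

h-∷ʳ : ∀ i p y → h i (p ∷ʳ y) ≡ comp (h i p) (1 + countLess y (i ∷ p)) (two y)
h-∷ʳ i = hGo-∷ʳ (two i) [ i ]

idx-h : ∀ i p → idx (h i p) ≡ i ∷ p
idx-h i = idx-hGo (two i) [ i ]

ar-h : ∀ i p → ar (h i p) ≡ 2 + length p
ar-h i p rewrite ar≡2+size (h i p) | size-hGo (two i) [ i ] p = refl

WF-h : ∀ i p → All (1 ≤_) (i ∷ p) → Unique (i ∷ p) → WF (h i p)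
WF-h i p pos uniq rewrite sym (idx-h i p) = ValidPos-hGo (two i) [ i ] p tt refl , pos , uniq

WF-h⇒Unique : ∀ i p → WF (h i p) → Unique (i ∷ p)
WF-h⇒Unique i p (_ , _ , uniq) = subst Unique (idx-h i p) uniq

countLess-++ : ∀ y xs ys → countLess y (xs ++ ys) ≡ countLess y xs + countLess y ys
countLess-++ y xs ys = trans (cong length (filter-++ (_<? y) xs ys)) (length-++ (filter (_<? y) xs))

countLess-split : ∀ y i p → All (i ≢_) p →
                  countLess y p ≡ countLess y (below i p) + countLess y (above i p)
countLess-split y i []      _           = refl
countLess-split y i (x ∷ p) (i≢x ∷ i∉p) with <-cmp x i
... | tri≈ _ x≡i _ = contradiction (sym x≡i) i≢x
... | tri< x<i _ _ = begin
  countLess y (x ∷ p)                        ≡⟨ countLess-++ y [ x ] p ⟩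
  cx + countLess y p                         ≡⟨ cong (cx +_) (countLess-split y i p i∉p) ⟩
  cx + (cB + cA)                             ≡⟨ +-assoc cx cB cA ⟨
  (cx + cB) + cA                             ≡⟨ cong (_+ cA) (countLess-++ y [ x ] (below i p)) ⟨
  countLess y (x ∷ below i p) + cA           ≡⟨ cong₂ (λ B A → countLess y B + countLess y A)
                                                   (filter-accept (_<? i) x<i)
                                                   (filter-reject (i <?_) (<⇒≯ x<i)) ⟨
  countLess y (below i (x ∷ p)) + countLess y (above i (x ∷ p)) ∎
  where
  open ≡-Reasoning
  cx = countLess y [ x ]; cB = countLess y (below i p); cA = countLess y (above i p)
... | tri> _ _ i<x = begin
  countLess y (x ∷ p)                        ≡⟨ countLess-++ y [ x ] p ⟩
  cx + countLess y p                         ≡⟨ cong (cx +_) (countLess-split y i p i∉p) ⟩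
  cx + (cB + cA)                             ≡⟨ x∙yz≈y∙xz +-commutativeSemigroup cx cB cA ⟩
  cB + (cx + cA)                             ≡⟨ cong (cB +_) (countLess-++ y [ x ] (above i p)) ⟨
  cB + countLess y (x ∷ above i p)           ≡⟨ cong₂ (λ B A → countLess y B + countLess y A)
                                                   (filter-reject (_<? i) (<⇒≯ i<x))
                                                   (filter-accept (i <?_) i<x) ⟨
  countLess y (below i (x ∷ p)) + countLess y (above i (x ∷ p)) ∎
  where
  open ≡-Reasoning
  cx = countLess y [ x ]; cB = countLess y (below i p); cA = countLess y (above i p)

countLess-none : ∀ {y xs} → All (y ≤_) xs → countLess y xs ≡ 0
countLess-none {y} y≤xs = cong length (filter-none (_<? y) (All.map ≤⇒≯ y≤xs))

countLess-all : ∀ {y xs} → All (_< y) xs → countLess y xs ≡ length xs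
countLess-all {y} xs<y = cong length (filter-all (_<? y) xs<y)

countLess-below : ∀ {y i} p → y < i → All (i ≢_) p → countLess y p ≡ countLess y (below i p)
countLess-below {y} {i} p y<i i∉p = begin
  countLess y p                                         ≡⟨ countLess-split y i p i∉p ⟩
  countLess y (below i p) + countLess y (above i p)     ≡⟨ cong (countLess y (below i p) +_) above≡0 ⟩
  countLess y (below i p) + 0                           ≡⟨ +-identityʳ _ ⟩
  countLess y (below i p)                               ∎
  where
  open ≡-Reasoning
  above≡0 = countLess-none (All.map (λ i<x → <⇒≤ (<-trans y<i i<x)) (All.all-filter (i <?_) p))

countLess-above : ∀ {y i} p → i < y → All (i ≢_) p →
                  countLess y p ≡ length (below i p) + countLess y (above i p)
countLess-above {y} {i} p i<y i∉p = begin
  countLess y p                                         ≡⟨ countLess-split y i p i∉p ⟩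
  countLess y (below i p) + countLess y (above i p)     ≡⟨ cong (_+ countLess y (above i p)) below≡all ⟩
  length (below i p) + countLess y (above i p)          ∎
  where
  open ≡-Reasoning
  below≡all = countLess-all (All.map (λ x<i → <-trans x<i i<y) (All.all-filter (_<? i) p))

insertPos-below : ∀ {y i} p → y < i → All (i ≢_) p →
                  1 + countLess y (i ∷ p) ≡ countLess y (below i p) + 1
insertPos-below {y} {i} p y<i i∉p = begin
  1 + countLess y (i ∷ p)        ≡⟨ cong (λ xs → 1 + length xs) (filter-reject (_<? y) (<⇒≯ y<i)) ⟩
  1 + countLess y p              ≡⟨ cong (1 +_) (countLess-below p y<i i∉p) ⟩
  1 + countLess y (below i p)    ≡⟨ +-comm 1 _ ⟩
  countLess y (below i p) + 1    ∎
  where open ≡-Reasoning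

insertPos-above : ∀ {y i} p → i < y → All (i ≢_) p →
                  1 + countLess y (i ∷ p) ≡ length (below i p) + (countLess y (above i p) + 2)
insertPos-above {y} {i} p i<y i∉p = begin
  1 + countLess y (i ∷ p)           ≡⟨ cong (λ xs → 1 + length xs) (filter-accept (_<? y) i<y) ⟩
  2 + countLess y p                 ≡⟨ cong (2 +_) (countLess-above p i<y i∉p) ⟩
  2 + (length lo + countLess y hi)  ≡⟨ +-comm 2 _ ⟩
  length lo + countLess y hi + 2    ≡⟨ +-assoc (length lo) _ 2 ⟩
  length lo + (countLess y hi + 2)  ∎
  where
  open ≡-Reasoning
  lo = below i p
  hi = above i p

assoc1-at : ∀ {A B C n m k} → m ∸ n + 1 ≡ k → WF (comp (comp A n B) m C) →
            n ≤ m → m < n + ar B → comp (comp A n B) m C =I comp A n (comp B k C)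
assoc1-at refl w = assoc1 _ _ _ _ _ w

assoc2-at : ∀ {A B C n m k} → m ∸ ar B + 1 ≡ k → WF (comp (comp A n B) m C) →
            n + ar B ≤ m → comp (comp A n B) m C =I comp (comp A k C) n B
assoc2-at refl w = assoc2 _ _ _ _ _ w

+∸suc+1≡ : ∀ n {r} → 1 ≤ r → n + r ∸ suc n + 1 ≡ r
+∸suc+1≡ n {suc s} _ = begin
  n + suc s ∸ suc n + 1  ≡⟨ cong (λ k → k ∸ suc n + 1) (+-suc n s) ⟩
  n + s ∸ n + 1          ≡⟨ cong (_+ 1) (m+n∸m≡n n s) ⟩
  s + 1                  ≡⟨ +-comm s 1 ⟩
  suc s                  ∎
  where open ≡-Reasoning

graft : Term → ℕ → List ℕ → Term
graft X m []       = X
graft X m (l ∷ ls) = comp X m (h l ls)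

-- node i B A is (2^i ∘₂ h(A)) ∘₁ h(B), with the grafts of empty words omitted:
-- the four right-hand sides of the theorem.
node : ℕ → List ℕ → List ℕ → Term
node i B A = graft (graft (two i) 2 A) 1 B

WF-graftˡ : ∀ {X} m B → WF (graft X m B) → WF X
WF-graftˡ m []      w = w
WF-graftˡ m (_ ∷ _) w = WF-compˡ w

graft-congˡ : ∀ {X X′} m B → X =I X′ → WF (graft X m B) → graft X m B =I graft X′ m B
graft-congˡ m []      X≈X′ _ = X≈X′
graft-congˡ m (_ ∷ _) X≈X′ w = comp-congˡ X≈X′ w

graft-∷ʳ : ∀ X m B y {k} → k ≡ countLess y B + m → WF (comp (graft X m B) k (two y)) →
           comp (graft X m B) k (two y) =I graft X m (B ∷ʳ y)
graft-∷ʳ X m []       y refl w = ≈refl w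
graft-∷ʳ X m (l ∷ ls) y refl w rewrite h-∷ʳ l ls y =
  assoc1-at pos≡ w (m≤n+m m c) (subst (_< m + ar (h l ls)) (+-comm m c) (+-monoʳ-< m c<ar))
  where
  c = countLess y (l ∷ ls)
  pos≡ : c + m ∸ m + 1 ≡ 1 + c
  pos≡ = trans (cong (_+ 1) (m+n∸n≡m c m)) (+-comm c 1)
  c<ar : c < ar (h l ls)
  c<ar = subst (c <_) (sym (ar-h l ls)) (s≤s (length-filter (_<? y) (l ∷ ls)))

graft₁-swap : ∀ X B r y → 2 ≤ r → WF (comp (graft X 1 B) (length B + r) (two y)) →
              comp (graft X 1 B) (length B + r) (two y) =I graft (comp X r (two y)) 1 B
graft₁-swap X []       r y _   w = ≈refl w
graft₁-swap X (l ∷ ls) r y 2≤r w = assoc2-at pos≡ w ar<pos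
  where
  n = length ls
  pos≡ : suc n + r ∸ ar (h l ls) + 1 ≡ r
  pos≡ = trans (cong (λ z → suc n + r ∸ z + 1) (ar-h l ls)) (+∸suc+1≡ (suc n) (≤-trans (s≤s z≤n) 2≤r))
  ar<pos : 1 + ar (h l ls) ≤ suc n + r
  ar<pos = subst (λ z → 1 + z ≤ suc n + r) (sym (ar-h l ls))
                 (s≤s (subst (_≤ n + r) (+-comm n 2) (+-monoʳ-≤ n 2≤r)))

node-∷ʳ-above : ∀ i B A y {k} → k ≡ length B + (countLess y A + 2) →
                WF (comp (node i B A) k (two y)) →
                comp (node i B A) k (two y) =I node i B (A ∷ʳ y)
node-∷ʳ-above i B A y refl w = ≈trans swapped
  (graft-congˡ 1 B (graft-∷ʳ (two i) 2 A y refl (WF-graftˡ 1 B w′)) w′)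
  where
  swapped = graft₁-swap (graft (two i) 2 A) B (countLess y A + 2) y (m≤n+m 2 _) w
  w′ = proj₂ (=I⇒WF swapped)

h-∷ʳ=I-node : ∀ i p y → WF (h i (p ∷ʳ y)) → h i p =I node i (below i p) (above i p) →
              h i (p ∷ʳ y) =I node i (below i (p ∷ʳ y)) (above i (p ∷ʳ y))
h-∷ʳ=I-node i p y w ih =
  subst (_=I node i (below i (p ∷ʳ y)) (above i (p ∷ʳ y))) (sym (h-∷ʳ i p y))
        (≈trans moved (insert (<-cmp y i)))
  where
  lo = below i p
  hi = above i p
  k = 1 + countLess y (i ∷ p)
  moved : comp (h i p) k (two y) =I comp (node i lo hi) k (two y)
  moved = comp-congˡ ih (subst WF (h-∷ʳ i p y) w)
  w′ = proj₂ (=I⇒WF moved)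
  i∉p∷ʳy : All (i ≢_) (p ∷ʳ y)
  i∉p∷ʳy = AllPairs.head (WF-h⇒Unique i (p ∷ʳ y) w)
  i∉p = All.++⁻ˡ p i∉p∷ʳy
  i≢y = All.head (All.++⁻ʳ p i∉p∷ʳy)
  insert : Tri (y < i) (y ≡ i) (i < y) →
           comp (node i lo hi) k (two y) =I node i (below i (p ∷ʳ y)) (above i (p ∷ʳ y))
  insert (tri≈ _ y≡i _) = contradiction (sym y≡i) i≢y
  insert (tri< y<i _ _) =
    subst₂ (λ lo′ hi′ → comp (node i lo hi) k (two y) =I node i lo′ hi′)
      (sym (filter-∷ʳ-accept (_<? i) p y<i)) (sym (filter-∷ʳ-reject (i <?_) p (<⇒≯ y<i)))
      (graft-∷ʳ (graft (two i) 2 hi) 1 lo y (insertPos-below p y<i i∉p) w′)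
  insert (tri> _ _ i<y) =
    subst₂ (λ lo′ hi′ → comp (node i lo hi) k (two y) =I node i lo′ hi′)
      (sym (filter-∷ʳ-reject (_<? i) p (<⇒≯ i<y))) (sym (filter-∷ʳ-accept (i <?_) p i<y))
      (node-∷ʳ-above i lo hi y (insertPos-above p i<y i∉p) w′)

h=I-node : ∀ i p → WF (h i p) → h i p =I node i (below i p) (above i p)
h=I-node i p = go (reverseView p)
  where
  go : ∀ {p} → Reverse p → WF (h i p) → h i p =I node i (below i p) (above i p)
  go []              w = ≈refl w
  go (p ∶ view ∶ʳ y) w = h-∷ʳ=I-node i p y w (go view (WF-compˡ (subst WF (h-∷ʳ i p y) w)))

lemma4p9 : (i : ℕ) (as : List ℕ) →
    All (1 ≤_) (i ∷ as) → Unique (i ∷ as) →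
    (∀ l ls g gs → below i (i ∷ as) ≡ l ∷ ls → above i (i ∷ as) ≡ g ∷ gs →
      h i as =I comp (comp (two i) 2 (h g gs)) 1 (h l ls))
    × (∀ g gs → below i (i ∷ as) ≡ [] → above i (i ∷ as) ≡ g ∷ gs →
      h i as =I comp (two i) 2 (h g gs))
    × (∀ l ls → above i (i ∷ as) ≡ [] → below i (i ∷ as) ≡ l ∷ ls →
      h i as =I comp (two i) 1 (h l ls))
    × (as ≡ [] → h i as ≡ two i)
lemma4p9 i as pos uniq =
    (λ _ _ _ _ → h=I-node-at)
  , (λ _ _ → h=I-node-at)
  , (λ _ _ above≡ below≡ → h=I-node-at below≡ above≡)
  , λ { refl → refl }
  where
  h=I-node-at : ∀ {B A} → below i (i ∷ as) ≡ B → above i (i ∷ as) ≡ A → h i as =I node i B A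
  h=I-node-at refl refl =
    subst₂ (λ B A → h i as =I node i B A)
      (sym (filter-reject (_<? i) (<-irrefl refl))) (sym (filter-reject (i <?_) (<-irrefl refl)))
      (h=I-node i as (WF-h i as pos uniq))
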